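{- Let $G_A(z,q)=\prod_{k=1}^\infty(1-z^{k-1}q^{2k-1})^{ -1}$, $G_B(z,q)=\prod_{k=1}^\infty(1-z^kq^{2k})^{ -1}$, and $F_n(z)=[q^n]\,G_A(z,q)G_B(z,q)$. Then for all $n\ge0$ and $0\le k\le n/3$, \[ [z^k]F_n(z)=[z^k]F_{n+1}(z)=\sum_{\ell=0}^k p(\ell)\,p(k-\ell), \] where $p(\ell)$ is the number of partitions of $\ell$.
   Context: $[q^n]$ and $[z^k]$ denote coefficient extraction. The product $G_AG_B$ is the Canfield–Savage–Wilf generating function $G_{2,2}(z,q)=\prod_{j\ge1}(1-z^{j-1}q^{2j-1})^{ -1}(1-z^jq^{2j})^{ -1}$ for partitions by the sum of their parts with even index. -}

module Defs where

open import Data.Nat using (ℕ; zero; suc; _+_; _*_; _∸_; _≡ᵇ_; _≤ᵇ_)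
open import Data.Bool using (Bool; true; false; _∧_; if_then_else_)

Σ≤ : ℕ → (ℕ → ℕ) → ℕ
Σ≤ zero    f = f 0
Σ≤ (suc n) f = Σ≤ n f + f (suc n)

-- Formal power series in two variables q, z with ℕ coefficients,
-- represented by their coefficient function:  S i j = [q^i z^j] S.
Series : Set
Series = ℕ → ℕ → ℕ

one : Series
one zero zero = 1
one _    _    = 0

_⊛_ : Series → Series → Series
(f ⊛ g) i j = Σ≤ i (λ a → Σ≤ j (λ b → f a b * g (i ∸ a) (j ∸ b)))

-- geom a b = 1/(1 - z^a q^b) = Σ_{m ≥ 0} z^(m a) q^(m b), for b ≥ 1.
-- [q^i z^j] is 1 iff i = m b and j = m a for some m (necessarily m ≤ i).
geom : ℕ → ℕ → Series
geom a b i j = Σ≤ i (λ m → if ((i ≡ᵇ m * b) ∧ (j ≡ᵇ m * a)) then 1 else 0)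

-- j-th factor of G_A : 1/(1 - z^(j-1) q^(2j-1)),  j ≥ 1 (given as j = suc t)
factorA : ℕ → Series
factorA t = geom t (2 * t + 1)

-- j-th factor of G_B : 1/(1 - z^j q^(2j)),  j = suc t
factorB : ℕ → Series
factorB t = geom (suc t) (2 * suc t)

GAB≤ : ℕ → Series
GAB≤ zero    = one
GAB≤ (suc N) = (GAB≤ N ⊛ factorA N) ⊛ factorB N

-- Factors with index j > n have q-degree ≥ 2j-1 > n,
-- hence do not affect the coefficient of q^n; so the coefficient of the
-- infinite product equals that of the partial product up to j = n.
coeffGAB : ℕ → ℕ → ℕ
coeffGAB n k = GAB≤ n n k

Fcoeff : ℕ → ℕ → ℕ
Fcoeff n k = coeffGAB n k

-- Partitions counted via multiplicity representation:
-- parts m ℓ = number of (c_1,...,c_m) ∈ ℕ^m with Σ_j j c_j = ℓ,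
-- i.e. the number of partitions of ℓ with all parts ≤ m.
-- (c_{m} ranges over c with c m ≤ ℓ; c ≤ ℓ suffices as bound.)
parts : ℕ → ℕ → ℕ
parts zero    ℓ = if ℓ ≡ᵇ 0 then 1 else 0
parts (suc m) ℓ =
  Σ≤ ℓ (λ c → if (c * suc m ≤ᵇ ℓ) then parts m (ℓ ∸ c * suc m) else 0)

-- p ℓ = number of partitions of ℓ (all parts are ≤ ℓ)
p : ℕ → ℕ
p ℓ = parts ℓ ℓ

-- Every factor 1/(1 - z^a q^b) of G_A G_B other than the first, 1/(1 - q), has
-- a ≥ 1 and b ≤ 3a.  If the coefficients [q^n z^k] of a series S depend only on
-- k in the range 3k ≤ n, then multiplying S by such a factor keeps every index
-- pair it reaches inside that range, so it acts there as 1/(1 - z^a) and the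
-- product again has coefficients depending only on k.  Starting from 1/(1 - q),
-- whose [q^n z^k] is [k = 0], the partial product up to index N+1 has, in that
-- range, [q^n z^k] = [z^k] ∏_{1≤d≤N} (1 - z^d)^{-1} · ∏_{1≤d≤N+1} (1 - z^d)^{-1},
-- and for k ≤ N both products may be extended to all d ≥ 1.
module Submission where

open import Defs
open import Data.Nat
  using (ℕ; zero; suc; _+_; _*_; _∸_; _≤_; _<_; _≤′_; ≤′-refl; ≤′-step; _≤ᵇ_; _≡ᵇ_; z≤n; s≤s; NonZero)
open import Data.Nat.Properties
open import Data.Bool using (Bool; true; false; _∧_; if_then_else_)
open import Data.Bool.Properties using (T-≡; ¬-not; ∧-comm)
open import Data.Product using (_×_; _,_)
open import Function.Bundles using (module Equivalence)
open import Relation.Nullary using (yes; no; contradiction)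
open import Relation.Nullary.Reflects using (ofʸ; ofⁿ)
open import Relation.Binary.PropositionalEquality
open import Algebra.Properties.CommutativeSemigroup +-commutativeSemigroup
  using (interchange)

≤ᵇ-true : ∀ {m n} → m ≤ n → (m ≤ᵇ n) ≡ true
≤ᵇ-true m≤n = Equivalence.to T-≡ (≤⇒≤ᵇ m≤n)

≤ᵇ-false : ∀ {m n} → n < m → (m ≤ᵇ n) ≡ false
≤ᵇ-false {m} {n} n<m = ¬-not (λ eq → <⇒≱ n<m (≤ᵇ⇒≤ m n (Equivalence.from T-≡ eq)))

≡ᵇ-true : ∀ {m n} → m ≡ n → (m ≡ᵇ n) ≡ true
≡ᵇ-true {m} {n} m≡n = Equivalence.to T-≡ (≡⇒≡ᵇ m n m≡n)

≡ᵇ-false : ∀ {m n} → m ≢ n → (m ≡ᵇ n) ≡ false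
≡ᵇ-false {m} {n} m≢n = ¬-not (λ eq → m≢n (≡ᵇ⇒≡ m n (Equivalence.from T-≡ eq)))

if-true : ∀ {b : Bool} {x y : ℕ} → b ≡ true → (if b then x else y) ≡ x
if-true refl = refl

if-false : ∀ {b : Bool} {x y : ℕ} → b ≡ false → (if b then x else y) ≡ y
if-false refl = refl

*-if-0 : ∀ b x → x * (if b then 1 else 0) ≡ (if b then x else 0)
*-if-0 true  x = *-identityʳ x
*-if-0 false x = *-zeroʳ x

if-0-* : ∀ b {x} y → (if b then x else 0) * y ≡ (if b then x * y else 0)
if-0-* true  y = refl
if-0-* false y = refl

Σ≤-cong : ∀ n {f g : ℕ → ℕ} → (∀ m → m ≤ n → f m ≡ g m) → Σ≤ n f ≡ Σ≤ n g
Σ≤-cong zero    f≗g = f≗g 0 z≤n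
Σ≤-cong (suc n) f≗g =
  cong₂ _+_ (Σ≤-cong n (λ m m≤n → f≗g m (m≤n⇒m≤1+n m≤n))) (f≗g (suc n) ≤-refl)

Σ≤-zero : ∀ n {f : ℕ → ℕ} → (∀ m → m ≤ n → f m ≡ 0) → Σ≤ n f ≡ 0
Σ≤-zero n f≗0 = trans (Σ≤-cong n f≗0) (go n)
  where
  go : ∀ n → Σ≤ n (λ _ → 0) ≡ 0
  go zero    = refl
  go (suc n) = trans (+-identityʳ _) (go n)

Σ≤-single : ∀ n j {f : ℕ → ℕ} → j ≤ n → (∀ m → m ≤ n → m ≢ j → f m ≡ 0) →
            Σ≤ n f ≡ f j
Σ≤-single zero .zero z≤n _ = refl
Σ≤-single (suc n) j {f} j≤1+n others with j ≟ suc n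
... | yes refl = cong (_+ f (suc n))
      (Σ≤-zero n (λ m m≤n → others m (m≤n⇒m≤1+n m≤n) (<⇒≢ (s≤s m≤n))))
... | no j≢1+n = trans
      (cong₂ _+_ (Σ≤-single n j (≤-pred (≤∧≢⇒< j≤1+n j≢1+n))
                   (λ m m≤n → others m (m≤n⇒m≤1+n m≤n)))
                 (others (suc n) ≤-refl (≢-sym j≢1+n)))
      (+-identityʳ _)

Σ≤-+ : ∀ n (f g : ℕ → ℕ) → Σ≤ n (λ m → f m + g m) ≡ Σ≤ n f + Σ≤ n g
Σ≤-+ zero    f g = refl
Σ≤-+ (suc n) f g = trans (cong (_+ (f (suc n) + g (suc n))) (Σ≤-+ n f g))
  (interchange (Σ≤ n f) (Σ≤ n g) (f (suc n)) (g (suc n)))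

Σ≤-*ˡ : ∀ n c (f : ℕ → ℕ) → Σ≤ n (λ m → c * f m) ≡ c * Σ≤ n f
Σ≤-*ˡ zero    c f = refl
Σ≤-*ˡ (suc n) c f = trans (cong (_+ c * f (suc n)) (Σ≤-*ˡ n c f))
  (sym (*-distribˡ-+ c (Σ≤ n f) (f (suc n))))

Σ≤-*ʳ : ∀ n c (f : ℕ → ℕ) → Σ≤ n (λ m → f m * c) ≡ Σ≤ n f * c
Σ≤-*ʳ n c f =
  trans (Σ≤-cong n (λ m _ → *-comm (f m) c)) (trans (Σ≤-*ˡ n c f) (*-comm c _))

Σ≤-swap : ∀ n k (F : ℕ → ℕ → ℕ) →
          Σ≤ n (λ a → Σ≤ k (F a)) ≡ Σ≤ k (λ b → Σ≤ n (λ a → F a b))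
Σ≤-swap zero    k F = refl
Σ≤-swap (suc n) k F = trans (cong (_+ Σ≤ k (F (suc n))) (Σ≤-swap n k F))
  (sym (Σ≤-+ k (λ b → Σ≤ n (λ a → F a b)) (F (suc n))))

Σ≤-suc : ∀ n (f : ℕ → ℕ) → Σ≤ (suc n) f ≡ f 0 + Σ≤ n (λ m → f (suc m))
Σ≤-suc zero    f = refl
Σ≤-suc (suc n) f =
  trans (cong (_+ f (suc (suc n))) (Σ≤-suc n f)) (+-assoc (f 0) _ _)

Σ≤-reverse : ∀ n (f : ℕ → ℕ) → Σ≤ n f ≡ Σ≤ n (λ m → f (n ∸ m))
Σ≤-reverse zero    f = refl
Σ≤-reverse (suc n) f = trans (+-comm (Σ≤ n f) (f (suc n)))
  (trans (cong (f (suc n) +_) (Σ≤-reverse n f))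
         (sym (Σ≤-suc n (λ m → f (suc n ∸ m)))))

Σ≤-truncate : ∀ {j} i {f : ℕ → ℕ} → j ≤ i → (∀ m → j < m → m ≤ i → f m ≡ 0) →
              Σ≤ i f ≡ Σ≤ j f
Σ≤-truncate {j} i {f} j≤i = go (≤⇒≤′ j≤i)
  where
  go : ∀ {i} → j ≤′ i → (∀ m → j < m → m ≤ i → f m ≡ 0) → Σ≤ i f ≡ Σ≤ j f
  go ≤′-refl _ = refl
  go {suc i} (≤′-step j≤′i) tail0 = trans
    (cong₂ _+_ (go j≤′i (λ m j<m m≤i → tail0 m j<m (m≤n⇒m≤1+n m≤i)))
               (tail0 (suc i) (s≤s (≤′⇒≤ j≤′i)) ≤-refl))
    (+-identityʳ _)

Σ≤-shift : ∀ b j (f : ℕ → ℕ) → b ≤ j → (∀ a → a < b → f a ≡ 0) →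
           Σ≤ j f ≡ Σ≤ (j ∸ b) (λ c → f (b + c))
Σ≤-shift zero    j       f _         _    = refl
Σ≤-shift (suc b) (suc j) f (s≤s b≤j) head0 = trans (Σ≤-suc j f)
  (trans (cong (_+ Σ≤ j (λ m → f (suc m))) (head0 0 (s≤s z≤n)))
         (Σ≤-shift b j (λ m → f (suc m)) b≤j (λ a a<b → head0 (suc a) (s≤s a<b))))

Σ≤-pick : ∀ n t (h : ℕ → ℕ) →
          Σ≤ n (λ x → if n ∸ x ≡ᵇ t then h x else 0) ≡ (if t ≤ᵇ n then h (n ∸ t) else 0)
Σ≤-pick n t h with t ≤ᵇ n | ≤ᵇ-reflects-≤ t n
... | true  | ofʸ t≤n = trans
  (Σ≤-single n (n ∸ t) (m∸n≤m n t) (λ x x≤n x≢ → if-false (≡ᵇ-false {n ∸ x} {t} (λ eq →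
     x≢ (trans (sym (m∸[m∸n]≡n x≤n)) (cong (n ∸_) eq))))))
  (if-true (≡ᵇ-true (m∸[m∸n]≡n t≤n)))
... | false | ofⁿ t≰n =
  Σ≤-zero n (λ x _ → if-false (≡ᵇ-false (λ eq → t≰n (subst (_≤ n) eq (m∸n≤m n x)))))

Σ≤-pick-∧ : ∀ n t (h : ℕ → ℕ) B →
            Σ≤ n (λ x → if B ∧ (n ∸ x ≡ᵇ t) then h x else 0) ≡
            (if B ∧ (t ≤ᵇ n) then h (n ∸ t) else 0)
Σ≤-pick-∧ n t h true  = Σ≤-pick n t h
Σ≤-pick-∧ n t h false = Σ≤-zero n (λ _ _ → refl)

conv : (ℕ → ℕ) → (ℕ → ℕ) → ℕ → ℕ
conv f g j = Σ≤ j (λ ℓ → f ℓ * g (j ∸ ℓ))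

-- f(z) / (1 - z^d) on coefficient sequences; by definition  parts (suc m) = geomMul (suc m) (parts m).
geomMul : ℕ → (ℕ → ℕ) → ℕ → ℕ
geomMul d f j = Σ≤ j (λ c → if c * d ≤ᵇ j then f (j ∸ c * d) else 0)

conv-comm : ∀ f g j → conv f g j ≡ conv g f j
conv-comm f g j = trans (Σ≤-reverse j _) (Σ≤-cong j (λ ℓ ℓ≤j →
  trans (cong (λ x → f (j ∸ ℓ) * g x) (m∸[m∸n]≡n ℓ≤j)) (*-comm (f (j ∸ ℓ)) (g ℓ))))

geomMul-cong : ∀ d {f g} → (∀ x → f x ≡ g x) → ∀ j → geomMul d f j ≡ geomMul d g j
geomMul-cong d {f} {g} f≗g j = Σ≤-cong j (λ c _ → cong-if (c * d ≤ᵇ j))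
  where
  cong-if : ∀ b {x} → (if b then f x else 0) ≡ (if b then g x else 0)
  cong-if true  = f≗g _
  cong-if false = refl

geomMul-convˡ : ∀ d .{{_ : NonZero d}} f g j →
                geomMul d (conv f g) j ≡ conv (geomMul d f) g j
geomMul-convˡ d f g j = sym (begin
    Σ≤ j (λ ℓ → Σ≤ ℓ (λ c → if c * d ≤ᵇ ℓ then f (ℓ ∸ c * d) else 0) * g (j ∸ ℓ))
  ≡⟨ Σ≤-cong j (λ ℓ _ → sym (Σ≤-*ʳ ℓ (g (j ∸ ℓ)) _)) ⟩
    Σ≤ j (λ ℓ → Σ≤ ℓ (λ c → (if c * d ≤ᵇ ℓ then f (ℓ ∸ c * d) else 0) * g (j ∸ ℓ)))
  ≡⟨ Σ≤-cong j (λ ℓ _ → Σ≤-cong ℓ (λ c _ → if-0-* (c * d ≤ᵇ ℓ) (g (j ∸ ℓ)))) ⟩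
    Σ≤ j (λ ℓ → Σ≤ ℓ (λ c → H ℓ c))
  ≡⟨ Σ≤-cong j (λ ℓ ℓ≤j → sym (Σ≤-truncate j ℓ≤j (λ c ℓ<c _ →
       if-false (≤ᵇ-false (<-≤-trans ℓ<c (m≤m*n c d)))))) ⟩
    Σ≤ j (λ ℓ → Σ≤ j (λ c → H ℓ c))
  ≡⟨ Σ≤-swap j j H ⟩
    Σ≤ j (λ c → Σ≤ j (λ ℓ → H ℓ c))
  ≡⟨ Σ≤-cong j (λ c _ → column c) ⟩
    Σ≤ j (λ c → if c * d ≤ᵇ j then conv f g (j ∸ c * d) else 0)
  ∎)
  where
  open ≡-Reasoning
  H : ℕ → ℕ → ℕ
  H ℓ c = if c * d ≤ᵇ ℓ then f (ℓ ∸ c * d) * g (j ∸ ℓ) else 0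
  column : ∀ c → Σ≤ j (λ ℓ → H ℓ c) ≡ (if c * d ≤ᵇ j then conv f g (j ∸ c * d) else 0)
  column c with c * d ≤ᵇ j | ≤ᵇ-reflects-≤ (c * d) j
  ... | true | ofʸ cd≤j = trans
    (Σ≤-shift (c * d) j (λ ℓ → H ℓ c) cd≤j (λ a a<cd → if-false (≤ᵇ-false a<cd)))
    (Σ≤-cong (j ∸ c * d) (λ ℓ _ → trans (if-true (≤ᵇ-true (m≤m+n (c * d) ℓ)))
       (cong₂ (λ x y → f x * g y) (m+n∸m≡n (c * d) ℓ) (sym (∸-+-assoc j (c * d) ℓ)))))
  ... | false | ofⁿ cd≰j =
    Σ≤-zero j (λ ℓ ℓ≤j → if-false (≤ᵇ-false (≤-<-trans ℓ≤j (≰⇒> cd≰j))))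

geomMul-convʳ : ∀ d .{{_ : NonZero d}} f g j →
                geomMul d (conv f g) j ≡ conv f (geomMul d g) j
geomMul-convʳ d f g j = trans (geomMul-cong d (conv-comm f g) j)
  (trans (geomMul-convˡ d g f j) (conv-comm (geomMul d g) f j))

parts-suc-stable : ∀ m ℓ → ℓ ≤ m → parts (suc m) ℓ ≡ parts m ℓ
parts-suc-stable m ℓ ℓ≤m = Σ≤-single ℓ 0 z≤n others
  where
  others : ∀ c → c ≤ ℓ → c ≢ 0 →
           (if c * suc m ≤ᵇ ℓ then parts m (ℓ ∸ c * suc m) else 0) ≡ 0
  others zero    _ c≢0 = contradiction refl c≢0
  others (suc c) _ _   = if-false (≤ᵇ-false (s≤s (≤-trans ℓ≤m (m≤m+n m _))))

parts-stable : ∀ m ℓ → ℓ ≤ m → parts m ℓ ≡ p ℓ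
parts-stable m ℓ ℓ≤m = go (≤⇒≤′ ℓ≤m)
  where
  go : ∀ {m} → ℓ ≤′ m → parts m ℓ ≡ p ℓ
  go ≤′-refl = refl
  go (≤′-step ℓ≤′m) = trans (parts-suc-stable _ ℓ (≤′⇒≤ ℓ≤′m)) (go ℓ≤′m)

conv-parts-stable : ∀ N k → k ≤ N →
                    conv (parts N) (parts (suc N)) k ≡ Σ≤ k (λ ℓ → p ℓ * p (k ∸ ℓ))
conv-parts-stable N k k≤N = Σ≤-cong k (λ ℓ ℓ≤k → cong₂ _*_
  (parts-stable N ℓ (≤-trans ℓ≤k k≤N))
  (parts-stable (suc N) (k ∸ ℓ) (≤-trans (m∸n≤m k ℓ) (m≤n⇒m≤1+n k≤N))))

conv-parts₀ : ∀ j → conv (parts 0) (parts 0) j ≡ parts 0 j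
conv-parts₀ j = trans (Σ≤-single j 0 z≤n others) (+-identityʳ _)
  where
  others : ∀ ℓ → ℓ ≤ j → ℓ ≢ 0 → parts 0 ℓ * parts 0 (j ∸ ℓ) ≡ 0
  others zero    _ ℓ≢0 = contradiction refl ℓ≢0
  others (suc ℓ) _ _   = refl

⊛-identityˡ : ∀ (S : Series) i j → (one ⊛ S) i j ≡ S i j
⊛-identityˡ S i j = trans
  (Σ≤-single i 0 z≤n (λ { zero _ a≢0 → contradiction refl a≢0
                        ; (suc a) _ _ → Σ≤-zero j (λ _ _ → refl) }))
  (trans (Σ≤-single j 0 z≤n (λ { zero _ b≢0 → contradiction refl b≢0
                                ; (suc b) _ _ → refl }))
         (+-identityʳ (S i j)))

geom-0-1 : ∀ i j → geom 0 1 i j ≡ parts 0 j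
geom-0-1 i j = trans (Σ≤-single i i ≤-refl others) diagonal
  where
  others : ∀ m → m ≤ i → m ≢ i →
           (if (i ≡ᵇ m * 1) ∧ (j ≡ᵇ m * 0) then 1 else 0) ≡ 0
  others m _ m≢i rewrite *-identityʳ m | ≡ᵇ-false (≢-sym m≢i) = refl
  diagonal : (if (i ≡ᵇ i * 1) ∧ (j ≡ᵇ i * 0) then 1 else 0) ≡ parts 0 j
  diagonal rewrite *-identityʳ i | *-zeroʳ i | ≡ᵇ-true (refl {x = i}) = refl

⊛-geom : ∀ (S : Series) a b .{{_ : NonZero b}} i j → (S ⊛ geom a b) i j ≡
         Σ≤ i (λ m → if (m * a ≤ᵇ j) ∧ (m * b ≤ᵇ i) then S (i ∸ m * b) (j ∸ m * a) else 0)
⊛-geom S a b i j = begin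
    Σ≤ i (λ x → Σ≤ j (λ y → S x y * Σ≤ (i ∸ x) (G x y)))
  ≡⟨ Σ≤-cong i (λ x _ → Σ≤-cong j (λ y _ → sym (Σ≤-*ˡ (i ∸ x) (S x y) (G x y)))) ⟩
    Σ≤ i (λ x → Σ≤ j (λ y → Σ≤ (i ∸ x) (λ m → S x y * G x y m)))
  ≡⟨ Σ≤-cong i (λ x _ → Σ≤-cong j (λ y _ → sym (Σ≤-truncate i (m∸n≤m i x)
       (λ m i∸x<m _ → trans (cong (λ c → S x y * (if c ∧ (j ∸ y ≡ᵇ m * a) then 1 else 0))
                                  (≡ᵇ-false (<⇒≢ (<-≤-trans i∸x<m (m≤m*n m b)))))
                            (*-zeroʳ (S x y)))))) ⟩
    Σ≤ i (λ x → Σ≤ j (λ y → Σ≤ i (λ m → S x y * G x y m)))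
  ≡⟨ Σ≤-cong i (λ x _ → Σ≤-swap j i (λ y m → S x y * G x y m)) ⟩
    Σ≤ i (λ x → Σ≤ i (λ m → Σ≤ j (λ y → S x y * G x y m)))
  ≡⟨ Σ≤-swap i i (λ x m → Σ≤ j (λ y → S x y * G x y m)) ⟩
    Σ≤ i (λ m → Σ≤ i (λ x → Σ≤ j (λ y → S x y * G x y m)))
  ≡⟨ Σ≤-cong i (λ m _ → Σ≤-cong i (λ x _ → row m x)) ⟩
    Σ≤ i (λ m → Σ≤ i (λ x → if (m * a ≤ᵇ j) ∧ (i ∸ x ≡ᵇ m * b) then S x (j ∸ m * a) else 0))
  ≡⟨ Σ≤-cong i (λ m _ → Σ≤-pick-∧ i (m * b) (λ x → S x (j ∸ m * a)) (m * a ≤ᵇ j)) ⟩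
    Σ≤ i (λ m → if (m * a ≤ᵇ j) ∧ (m * b ≤ᵇ i) then S (i ∸ m * b) (j ∸ m * a) else 0)
  ∎
  where
  open ≡-Reasoning
  G : ℕ → ℕ → ℕ → ℕ
  G x y m = if (i ∸ x ≡ᵇ m * b) ∧ (j ∸ y ≡ᵇ m * a) then 1 else 0
  row : ∀ m x → Σ≤ j (λ y → S x y * G x y m) ≡
        (if (m * a ≤ᵇ j) ∧ (i ∸ x ≡ᵇ m * b) then S x (j ∸ m * a) else 0)
  row m x = trans (Σ≤-cong j (λ y _ → *-if-0 _ (S x y)))
    (trans (Σ≤-pick-∧ j (m * a) (S x) (i ∸ x ≡ᵇ m * b))
           (cong (λ c → if c then S x (j ∸ m * a) else 0) (∧-comm (i ∸ x ≡ᵇ m * b) _)))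

⊛-geom-stable : ∀ (S : Series) (h : ℕ → ℕ) a b .{{_ : NonZero a}} .{{_ : NonZero b}} →
  b ≤ 3 * a → (∀ i j → 3 * j ≤ i → S i j ≡ h j) →
  ∀ i j → 3 * j ≤ i → (S ⊛ geom a b) i j ≡ geomMul a h j
⊛-geom-stable S h a b b≤3a S≗h i j 3j≤i = trans (⊛-geom S a b i j)
  (trans (Σ≤-truncate i (≤-trans (m≤m+n j _) 3j≤i)
           (λ m j<m _ → cong (λ c → if c then S (i ∸ m * b) (j ∸ m * a) else 0)
                             (cong (_∧ _) (≤ᵇ-false (<-≤-trans j<m (m≤m*n m a))))))
         (Σ≤-cong j (λ m _ → term m)))
  where
  term : ∀ m → (if (m * a ≤ᵇ j) ∧ (m * b ≤ᵇ i) then S (i ∸ m * b) (j ∸ m * a) else 0)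
             ≡ (if m * a ≤ᵇ j then h (j ∸ m * a) else 0)
  term m with m * a ≤ᵇ j | ≤ᵇ-reflects-≤ (m * a) j
  ... | false | ofⁿ _ = refl
  ... | true | ofʸ ma≤j = trans (if-true (≤ᵇ-true mb≤i))
                                (S≗h (i ∸ m * b) (j ∸ m * a) in-range)
    where
    mb≤3ma : m * b ≤ 3 * (m * a)
    mb≤3ma = ≤-trans (*-monoʳ-≤ m b≤3a)
      (≤-reflexive (trans (sym (*-assoc m 3 a))
                          (trans (cong (_* a) (*-comm m 3)) (*-assoc 3 m a))))
    mb≤i : m * b ≤ i
    mb≤i = ≤-trans mb≤3ma (≤-trans (*-monoʳ-≤ 3 ma≤j) 3j≤i)
    in-range : 3 * (j ∸ m * a) ≤ i ∸ m * b
    in-range = ≤-trans (≤-reflexive (*-distribˡ-∸ 3 j (m * a))) (∸-mono 3j≤i mb≤3ma)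

2[1+n]+1≤3[1+n] : ∀ n → 2 * suc n + 1 ≤ 3 * suc n
2[1+n]+1≤3[1+n] n =
  ≤-trans (+-monoʳ-≤ (2 * suc n) (s≤s z≤n)) (≤-reflexive (+-comm (2 * suc n) (suc n)))

2n≤3n : ∀ n → 2 * n ≤ 3 * n
2n≤3n n = *-monoˡ-≤ n {2} {3} (s≤s (s≤s z≤n))

GAB≤-A-stable : ∀ N i j → 3 * j ≤ i →
                (GAB≤ N ⊛ factorA N) i j ≡ conv (parts N) (parts N) j
GAB≤-stable : ∀ N i j → 3 * j ≤ i →
              GAB≤ (suc N) i j ≡ conv (parts N) (parts (suc N)) j

GAB≤-A-stable zero i j _ =
  trans (⊛-identityˡ (geom 0 1) i j) (trans (geom-0-1 i j) (sym (conv-parts₀ j)))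
GAB≤-A-stable (suc N) i j 3j≤i = trans
  (⊛-geom-stable (GAB≤ (suc N)) _ (suc N) (2 * suc N + 1)
                 (2[1+n]+1≤3[1+n] N) (GAB≤-stable N) i j 3j≤i)
  (geomMul-convˡ (suc N) (parts N) (parts (suc N)) j)

GAB≤-stable N i j 3j≤i = trans
  (⊛-geom-stable (GAB≤ N ⊛ factorA N) _ (suc N) (2 * suc N)
                 (2n≤3n (suc N)) (GAB≤-A-stable N) i j 3j≤i)
  (geomMul-convʳ (suc N) (parts N) (parts N) j)

3k≤1+n⇒k≤n : ∀ k n → 3 * k ≤ suc n → k ≤ n
3k≤1+n⇒k≤n zero    n _  = z≤n
3k≤1+n⇒k≤n (suc k) n 3k≤1+n =
  ≤-trans (≤-trans (m≤n+m (suc k) k) (+-monoʳ-≤ k (m≤m+n (suc k) _))) (≤-pred 3k≤1+n)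

Fcoeff-stable : ∀ n k → 3 * k ≤ n → Fcoeff n k ≡ Σ≤ k (λ ℓ → p ℓ * p (k ∸ ℓ))
Fcoeff-stable zero    zero _ = refl
Fcoeff-stable (suc N) k 3k≤n = trans (GAB≤-stable N (suc N) k 3k≤n)
  (conv-parts-stable N k (3k≤1+n⇒k≤n k N 3k≤n))

theorem4 : (n k : ℕ) → 3 * k ≤ n →
    (Fcoeff n k ≡ Fcoeff (suc n) k)
    × (Fcoeff (suc n) k ≡ Σ≤ k (λ ℓ → p ℓ * p (k ∸ ℓ)))
theorem4 n k 3k≤n = trans (Fcoeff-stable n k 3k≤n) (sym next) , next
  where
  next : Fcoeff (suc n) k ≡ Σ≤ k (λ ℓ → p ℓ * p (k ∸ ℓ))
  next = Fcoeff-stable (suc n) k (m≤n⇒m≤1+n 3k≤n)
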